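{- If $T$ is a quadrangular tournament with $\delta^{+}(T)\geq 2$ and $\delta^{ - }(T)\geq 2$, then $\delta^{+}(T)\geq 4$ and $\delta^{ - }(T)\geq 4$.
   Context: A tournament $T$ is a loopless digraph in which for each pair of distinct vertices exactly one of $(u,v)$, $(v,u)$ is an arc. $O(v)$ is the set of vertices $v$ beats and $I(v)$ the set of vertices beating $v$. A digraph is quadrangular if for all distinct $u,v$, $|O(u)\cap O(v)|\neq 1$ and $|I(u)\cap I(v)|\neq 1$. $\delta^{+}(T)$, $\delta^{ - }(T)$ are the minimum out-degree and minimum in-degree of $T$. -}

module Defs where

open import Data.Nat using (ℕ; _≥_)
open import Data.Fin using (Fin)
open import Data.Bool using (Bool; true; false; _∧_; not)
open import Data.List using (List; length; filterᵇ; allFin)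
open import Relation.Binary.PropositionalEquality using (_≡_; _≢_)
open import Data.Product using (_×_)
open import Relation.Nullary using (¬_)

-- A digraph on vertex set Fin n, given by its arc relation:
-- arc u v ≡ true  iff  (u , v) is an arc (u beats v).
Digraph : ℕ → Set
Digraph n = Fin n → Fin n → Bool

record IsTournament {n : ℕ} (T : Digraph n) : Set where
  field
    loopless : ∀ v → T v v ≡ false
    exactly-one : ∀ u v → u ≢ v → T v u ≡ not (T u v)

count : {n : ℕ} → (Fin n → Bool) → ℕ
count {n} p = length (filterᵇ p (allFin n))

outdeg : {n : ℕ} → Digraph n → Fin n → ℕ
outdeg T v = count (λ w → T v w)

indeg : {n : ℕ} → Digraph n → Fin n → ℕ
indeg T v = count (λ w → T w v)

commonOut : {n : ℕ} → Digraph n → Fin n → Fin n → ℕ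
commonOut T u v = count (λ w → T u w ∧ T v w)

commonIn : {n : ℕ} → Digraph n → Fin n → Fin n → ℕ
commonIn T u v = count (λ w → T w u ∧ T w v)

Quadrangular : {n : ℕ} → Digraph n → Set
Quadrangular T = ∀ u v → u ≢ v → (commonOut T u v ≢ 1) × (commonIn T u v ≢ 1)

MinOutDeg≥ : {n : ℕ} → Digraph n → ℕ → Set
MinOutDeg≥ T k = ∀ v → outdeg T v ≥ k

MinInDeg≥ : {n : ℕ} → Digraph n → ℕ → Set
MinInDeg≥ T k = ∀ v → indeg T v ≥ k

{-# OPTIONS --safe #-}
module Submission where

-- If v has out-degree 2 or 3, the subtournament induced on its out-neighbourhood
-- O(v) has 2 or 3 vertices, and every such tournament has a vertex u beating exactly
-- one of the others. Then O(v) ∩ O(u) is that single vertex, against quadrangularity.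
-- The in-degree bound is the same argument applied to the converse tournament.

open import Defs
open import Data.Nat using (ℕ; zero; suc; _≤_; _<_; _≥_; s≤s)
open import Data.Nat.Properties using (≮⇒≥)
open import Data.Product using (_×_; _,_; proj₁; proj₂)
open import Data.Sum using (_⊎_; inj₁; inj₂; [_,_]′)
open import Data.Fin using (Fin)
open import Data.Bool as Bool using (Bool; true; false; _∧_; not)
open import Data.List using (List; []; _∷_; length; map; filterᵇ; allFin)
open import Data.List.Relation.Unary.All using (lookupAny; []; _∷_)
open import Data.List.Relation.Unary.All.Properties using (all-filter)
open import Data.List.Relation.Unary.Any using (Any; here; there)
open import Data.List.Relation.Unary.AllPairs using ([]; _∷_)
open import Data.List.Relation.Unary.Unique.Propositional using (Unique)
import Data.List.Relation.Unary.Unique.Propositional.Properties as Unique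
open import Function using (_∘_)
open import Relation.Binary.PropositionalEquality
  using (_≡_; _≢_; _≗_; refl; sym; trans; cong; cong₂; subst)
open import Relation.Nullary using (¬_)
open import Relation.Nullary.Decidable using (T?)

private
  variable
    A : Set
    n : ℕ

filterᵇ-∧ : (p q : A → Bool) → filterᵇ (λ x → p x ∧ q x) ≗ filterᵇ q ∘ filterᵇ p
filterᵇ-∧ p q [] = refl
filterᵇ-∧ p q (x ∷ xs) with p x
... | false = filterᵇ-∧ p q xs
... | true with q x
...   | false = filterᵇ-∧ p q xs
...   | true  = cong (x ∷_) (filterᵇ-∧ p q xs)

trues : List Bool → ℕ
trues []           = zero
trues (false ∷ bs) = trues bs
trues (true  ∷ bs) = suc (trues bs)

length-filterᵇ : (p : A → Bool) → length ∘ filterᵇ p ≗ trues ∘ map p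
length-filterᵇ p [] = refl
length-filterᵇ p (x ∷ xs) with p x
... | false = length-filterᵇ p xs
... | true  = cong suc (length-filterᵇ p xs)

-- Adjacency rows of a tournament on two vertices a, b with x = [a → b], resp. on
-- three vertices a, b, c with x = [a → b], y = [a → c], z = [b → c].
single-arc-row₂ : ∀ x → trues (false ∷ x ∷ []) ≡ 1 ⊎ trues (not x ∷ false ∷ []) ≡ 1
single-arc-row₂ false = inj₂ refl
single-arc-row₂ true  = inj₁ refl

single-arc-row₃ : ∀ x y z →
  trues (false ∷ x ∷ y ∷ []) ≡ 1 ⊎ trues (not x ∷ false ∷ z ∷ []) ≡ 1 ⊎
  trues (not y ∷ not z ∷ false ∷ []) ≡ 1
single-arc-row₃ true  true  true  = inj₂ (inj₁ refl)
single-arc-row₃ true  true  false = inj₂ (inj₂ refl)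
single-arc-row₃ true  false _     = inj₁ refl
single-arc-row₃ false true  _     = inj₁ refl
single-arc-row₃ false false true  = inj₂ (inj₂ refl)
single-arc-row₃ false false false = inj₂ (inj₁ refl)

outdegIn : Digraph n → Fin n → List (Fin n) → ℕ
outdegIn T u L = length (filterᵇ (T u) L)

outdegIn-row : (T : Digraph n) {u : Fin n} {L : List (Fin n)} {r : List Bool} →
  map (T u) L ≡ r → outdegIn T u L ≡ trues r
outdegIn-row T {u} {L} refl = length-filterᵇ (T u) L

outneighbours : Digraph n → Fin n → List (Fin n)
outneighbours {n} T v = filterᵇ (T v) (allFin n)

commonOut≡outdegIn : (T : Digraph n) (v u : Fin n) →
  commonOut T v u ≡ outdegIn T u (outneighbours T v)
commonOut≡outdegIn {n} T v u = cong length (filterᵇ-∧ (T v) (T u) (allFin n))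

converse : Digraph n → Digraph n
converse T u v = T v u

converse-isTournament : {T : Digraph n} → IsTournament T → IsTournament (converse T)
converse-isTournament t = record
  { loopless    = loopless
  ; exactly-one = λ u v u≢v → exactly-one v u (u≢v ∘ sym)
  }
  where open IsTournament t

OutQuadrangular : Digraph n → Set
OutQuadrangular T = ∀ u v → u ≢ v → commonOut T u v ≢ 1

quadrangular⇒outQuadrangular : {T : Digraph n} → Quadrangular T → OutQuadrangular T
quadrangular⇒outQuadrangular Q u v = proj₁ ∘ Q u v

quadrangular⇒converse-outQuadrangular : {T : Digraph n} →
  Quadrangular T → OutQuadrangular (converse T)
quadrangular⇒converse-outQuadrangular Q u v = proj₂ ∘ Q u v

module _ {T : Digraph n} (tournament : IsTournament T) where
  open IsTournament tournament

  arc⇒≢ : ∀ {u v} → Bool.T (T u v) → u ≢ v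
  arc⇒≢ {u} uv refl = subst Bool.T (loopless u) uv

  small-tournament-has-outdegIn≡1 : (L : List (Fin n)) → Unique L →
    2 ≤ length L → length L < 4 → Any (λ u → outdegIn T u L ≡ 1) L
  small-tournament-has-outdegIn≡1 [] _ () _
  small-tournament-has-outdegIn≡1 (_ ∷ []) _ (s≤s ()) _
  small-tournament-has-outdegIn≡1 (a ∷ b ∷ []) ((a≢b ∷ []) ∷ [] ∷ []) _ _ =
    [ here ∘ trans (outdegIn-row T row-a) , there ∘ here ∘ trans (outdegIn-row T row-b) ]′
      (single-arc-row₂ (T a b))
    where
    row-a : map (T a) (a ∷ b ∷ []) ≡ false ∷ T a b ∷ []
    row-a = cong₂ _∷_ (loopless a) refl
    row-b : map (T b) (a ∷ b ∷ []) ≡ not (T a b) ∷ false ∷ []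
    row-b = cong₂ _∷_ (exactly-one a b a≢b) (cong₂ _∷_ (loopless b) refl)
  small-tournament-has-outdegIn≡1 (a ∷ b ∷ c ∷ [])
    ((a≢b ∷ a≢c ∷ []) ∷ (b≢c ∷ []) ∷ [] ∷ []) _ _ =
    [ here ∘ trans (outdegIn-row T row-a)
    , [ there ∘ here ∘ trans (outdegIn-row T row-b)
      , there ∘ there ∘ here ∘ trans (outdegIn-row T row-c) ]′ ]′
      (single-arc-row₃ (T a b) (T a c) (T b c))
    where
    row-a : map (T a) (a ∷ b ∷ c ∷ []) ≡ false ∷ T a b ∷ T a c ∷ []
    row-a = cong₂ _∷_ (loopless a) refl
    row-b : map (T b) (a ∷ b ∷ c ∷ []) ≡ not (T a b) ∷ false ∷ T b c ∷ []
    row-b = cong₂ _∷_ (exactly-one a b a≢b) (cong₂ _∷_ (loopless b) refl)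
    row-c : map (T c) (a ∷ b ∷ c ∷ []) ≡ not (T a c) ∷ not (T b c) ∷ false ∷ []
    row-c = cong₂ _∷_ (exactly-one a c a≢c)
              (cong₂ _∷_ (exactly-one b c b≢c) (cong₂ _∷_ (loopless c) refl))
  small-tournament-has-outdegIn≡1 (_ ∷ _ ∷ _ ∷ _ ∷ _) _ _ (s≤s (s≤s (s≤s (s≤s ()))))

  outdeg≥2⇒outdeg≥4 : OutQuadrangular T → ∀ v → outdeg T v ≥ 2 → outdeg T v ≥ 4
  outdeg≥2⇒outdeg≥4 quadrangular v outdeg≥2 = ≮⇒≥ λ outdeg<4 →
    no-single-common-outneighbour
      (small-tournament-has-outdegIn≡1 (outneighbours T v) unique outdeg≥2 outdeg<4)
    where
    unique : Unique (outneighbours T v)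
    unique = Unique.filter⁺ (T? ∘ T v) (Unique.allFin⁺ n)

    no-single-common-outneighbour :
      ¬ Any (λ u → outdegIn T u (outneighbours T v) ≡ 1) (outneighbours T v)
    no-single-common-outneighbour any
      with vu , outdegIn≡1 ← lookupAny (all-filter (T? ∘ T v) (allFin n)) any =
      quadrangular v _ (arc⇒≢ vu) (trans (commonOut≡outdegIn T v _) outdegIn≡1)

corollary13 : (n : ℕ) (T : Digraph n) → IsTournament T → Quadrangular T →
    MinOutDeg≥ T 2 → MinInDeg≥ T 2 → MinOutDeg≥ T 4 × MinInDeg≥ T 4
corollary13 n T tournament quadrangular δ⁺≥2 δ⁻≥2 =
    (λ v → outdeg≥2⇒outdeg≥4 tournament
             (quadrangular⇒outQuadrangular {T = T} quadrangular) v (δ⁺≥2 v))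
  , (λ v → outdeg≥2⇒outdeg≥4 (converse-isTournament tournament)
             (quadrangular⇒converse-outQuadrangular {T = T} quadrangular) v (δ⁻≥2 v))
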